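{- Let $c,h\in\omega^\omega$ with $c>0$ and $h(i)\ge1$ for all but finitely many $i$. Suppose $c'$ is a function with domain $\omega$ whose values are non-empty sets, and $h'\in\omega^\omega$, such that for all but finitely many $i<\omega$, $|c'(i)|\ge|[c(i)]^{\le h(i)}\setminus\{\emptyset\}|$ and $h'(i)<c(i)/h(i)$. Then $\mathbf{aLc}(c,h)\preceq_T\mathbf{Lc}(c',h')$. In particular, $\mathfrak{v}^\forall_{c',h'}\le\mathfrak{c}^\exists_{c,h}$ and $\mathfrak{v}^\exists_{c,h}\le\mathfrak{c}^\forall_{c',h'}$.
   Context: Natural numbers are identified with $\{0,\dots,n-1\}$ (so a natural number or cardinal is the set of smaller ordinals). For a sequence $e=\langle e(i)\rangle$ of non-empty sets and $k\in\omega^\omega$: $\prod e=\prod_i e(i)$, $\mathcal{S}(e,k)=\prod_i[e(i)]^{\le k(i)}$; $x\in^*y$ iff $x(i)\in y(i)$ for almost all $i$; $x\notin^\infty y$ iff $x(i)\notin y(i)$ for almost all $i$. $\mathbf{Lc}(e,k):=\langle\prod e,\mathcal{S}(e,k),\in^*\rangle$ and $\mathbf{aLc}(e,k):=\langle\mathcal{S}(e,k),\prod e,R\rangle$ with $\varphi Ry$ iff $y\notin^\infty\varphi$. $\mathfrak{v}^\forall_{e,k}:=\min\{|F|\mid F\subseteq\prod e,\ \neg\exists\varphi\in\mathcal{S}(e,k)\ \forall x\in F: x\in^*\varphi\}$; $\mathfrak{c}^\forall_{e,k}:=\min\{|S|\mid S\subseteq\mathcal{S}(e,k),\ \forall x\in\prod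 e\ \exists\varphi\in S: x\in^*\varphi\}$; $\mathfrak{v}^\exists_{e,k}:=\min\{|E|\mid E\subseteq\prod e,\ \forall\varphi\in\mathcal{S}(e,k)\ \exists y\in E: y\notin^\infty\varphi\}$; $\mathfrak{c}^\exists_{e,k}:=\min\{|R_0|\mid R_0\subseteq\mathcal{S}(e,k),\ \neg\exists y\in\prod e\ \forall\varphi\in R_0: y\notin^\infty\varphi\}$. A Tukey connection from $\langle X,Y,\sqsubset\rangle$ to $\langle X',Y',\sqsubset'\rangle$ is $(F,G)$, $F:X\to X'$, $G:Y'\to Y$, with $F(x)\sqsubset'y'\Rightarrow x\sqsubset G(y')$; $\preceq_T$ denotes existence of one. -}

module Defs where

open import Data.Nat using (ℕ; _≤_; _<_; _*_)
open import Data.Fin using (Fin)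
open import Data.Fin.Subset using (Subset; ∣_∣)
open import Data.List using (List; length)
open import Data.List.Membership.Propositional using (_∈_)
open import Data.Product using (Σ; _×_; _,_; proj₁)
open import Relation.Nullary using (¬_)
open import Relation.Binary.PropositionalEquality using (_≡_)

AlmostAll : (ℕ → Set) → Set
AlmostAll P = Σ ℕ λ N → ∀ i → N ≤ i → P i

Prod : (ℕ → Set) → Set
Prod e = (i : ℕ) → e i

-- [A]^{≤k}: finite subsets of A of size ≤ k, presented as lists of length ≤ k
-- (the subset is the set of list elements; membership is list membership)
FinSubsetLe : Set → ℕ → Set
FinSubsetLe A k = Σ (List A) λ l → length l ≤ k

Slalom : (ℕ → Set) → (ℕ → ℕ) → Set
Slalom e k = (i : ℕ) → FinSubsetLe (e i) (k i)

_∈*_ : {e : ℕ → Set} {k : ℕ → ℕ} → Prod e → Slalom e k → Set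
x ∈* φ = AlmostAll λ i → x i ∈ proj₁ (φ i)

_∉∞_ : {e : ℕ → Set} {k : ℕ → ℕ} → Prod e → Slalom e k → Set
y ∉∞ φ = AlmostAll λ i → ¬ (y i ∈ proj₁ (φ i))

record RelSys : Set₁ where
  field
    X : Set
    Y : Set
    R : X → Y → Set
open RelSys public

Lc : (ℕ → Set) → (ℕ → ℕ) → RelSys
Lc e k = record { X = Prod e ; Y = Slalom e k ; R = λ x φ → x ∈* φ }

aLc : (ℕ → Set) → (ℕ → ℕ) → RelSys
aLc e k = record { X = Slalom e k ; Y = Prod e ; R = λ φ y → y ∉∞ φ }

_⪯T_ : RelSys → RelSys → Set
A ⪯T B = Σ (X A → X B) λ F → Σ (Y B → Y A) λ G →
  ∀ (x : X A) (y' : Y B) → R B (F x) y' → R A x (G y')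

-- the natural number n as a set {0,…,n-1}
nat : (ℕ → ℕ) → ℕ → Set
nat c i = Fin (c i)

NonemptySubsetsLe : ℕ → ℕ → Set
NonemptySubsetsLe n k = Σ (Subset n) λ s → (0 < ∣ s ∣) × (∣ s ∣ ≤ k)

-- |A| ≤ |B|, witnessed by a retraction pair (an injection f with a left inverse g)
CardLe : Set → Set → Set
CardLe A B = Σ (A → B) λ f → Σ (B → A) λ g → ∀ a → g (f a) ≡ a

module Submission where

-- A Tukey connection aLc(c,h) ⪯T Lc(c',h') can be assembled
-- coordinate by coordinate: at each coordinate i beyond some threshold it
-- suffices to have maps f : [c(i)]^{≤h(i)} → c'(i) and g : [c'(i)]^{≤h'(i)} → c(i)
-- with  f(s) ∈ t  ⇒  g(t) ∉ s  (a "local connection"); below the threshold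
-- arbitrary default values do.  Such a local connection exists when
-- [c(i)]^{≤h(i)} ∖ {∅} embeds into c'(i) and h'(i)·h(i) < c(i):  f sends a
-- non-empty s to its code, and g decodes the at most h'(i) codes in t back into
-- subsets of size ≤ h(i); their union has fewer than c(i) elements, so g can
-- pick a point outside it.  The two cardinal inequalities are then the
-- general fact that Tukey connections transport unbounded families forwards
-- and dominating families backwards.

open import Defs
open import Data.Nat using (ℕ; suc; _≤_; _<_; _*_; _+_; z≤n; s≤s; _≤?_; _⊔_)
open import Data.Nat.Properties
  using (≤-trans; +-mono-≤; +-suc; m≤n⇒m≤1+n; *-monoˡ-≤; *-identityʳ; ≤-<-trans; m≤m⊔n; m≤n⊔m)
open import Data.Product using (Σ; _×_; _,_; proj₁; proj₂)
open import Data.Sum using (inj₁; inj₂)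
open import Data.Fin using (Fin; fromℕ<) renaming (zero to fzero; suc to fsuc)
open import Data.List using (List; []; _∷_; length; map)
open import Data.List.Relation.Unary.Any using (here; there)
open import Data.List.Membership.Propositional using (_∈_)
open import Data.Vec using ([]; _∷_; here; there)
open import Data.Fin.Subset as Sub using (Subset; ∣_∣; _∪_; ⁅_⁆; ⋃; inside; outside)
open import Data.Fin.Subset.Properties using (x∈⁅x⁆; x∈p∪q⁺; ∣⁅x⁆∣≡1; ∣⊥∣≡0)
open import Relation.Nullary using (¬_; yes; no)
open import Relation.Binary.PropositionalEquality using (_≡_; refl; subst; sym)
open import Data.Empty using (⊥-elim)
open import Function using (id)

almostAll-combine : {P Q R : ℕ → Set} → AlmostAll P → AlmostAll Q →
  (∀ i → P i → Q i → R i) → AlmostAll R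
almostAll-combine (M , p) (N , q) pq⇒r =
  M ⊔ N , λ i M⊔N≤i → pq⇒r i (p i (≤-trans (m≤m⊔n M N) M⊔N≤i)) (q i (≤-trans (m≤n⊔m M N) M⊔N≤i))

∣p∪q∣≤∣p∣+∣q∣ : ∀ {n} (p q : Subset n) → ∣ p ∪ q ∣ ≤ ∣ p ∣ + ∣ q ∣
∣p∪q∣≤∣p∣+∣q∣ [] [] = z≤n
∣p∪q∣≤∣p∣+∣q∣ (outside ∷ p) (outside ∷ q) = ∣p∪q∣≤∣p∣+∣q∣ p q
∣p∪q∣≤∣p∣+∣q∣ (inside ∷ p) (outside ∷ q) = s≤s (∣p∪q∣≤∣p∣+∣q∣ p q)
∣p∪q∣≤∣p∣+∣q∣ (outside ∷ p) (inside ∷ q) =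
  subst (suc ∣ p ∪ q ∣ ≤_) (sym (+-suc ∣ p ∣ ∣ q ∣)) (s≤s (∣p∪q∣≤∣p∣+∣q∣ p q))
∣p∪q∣≤∣p∣+∣q∣ (inside ∷ p) (inside ∷ q) =
  s≤s (subst (∣ p ∪ q ∣ ≤_) (sym (+-suc ∣ p ∣ ∣ q ∣)) (m≤n⇒m≤1+n (∣p∪q∣≤∣p∣+∣q∣ p q)))

∣⋃-map∣≤ : ∀ {A : Set} {n k} (f : A → Subset n) → (∀ a → ∣ f a ∣ ≤ k) →
  (as : List A) → ∣ ⋃ (map f as) ∣ ≤ length as * k
∣⋃-map∣≤ {n = n} f f≤k [] = subst (_≤ 0) (sym (∣⊥∣≡0 n)) z≤n
∣⋃-map∣≤ f f≤k (a ∷ as) =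
  ≤-trans (∣p∪q∣≤∣p∣+∣q∣ (f a) (⋃ (map f as))) (+-mono-≤ (f≤k a) (∣⋃-map∣≤ f f≤k as))

∈-⋃-map : ∀ {A : Set} {n} {x : Fin n} {a : A} (f : A → Subset n) (as : List A) →
  a ∈ as → x Sub.∈ f a → x Sub.∈ ⋃ (map f as)
∈-⋃-map f (b ∷ as) (here refl) x∈fa = x∈p∪q⁺ (inj₁ x∈fa)
∈-⋃-map f (b ∷ as) (there a∈as) x∈fa = x∈p∪q⁺ (inj₂ (∈-⋃-map f as a∈as x∈fa))

∈⇒∣p∣>0 : ∀ {n} {x : Fin n} {p : Subset n} → x Sub.∈ p → 0 < ∣ p ∣
∈⇒∣p∣>0 {p = inside ∷ p} here = s≤s z≤n
∈⇒∣p∣>0 {p = inside ∷ p} (there _) = s≤s z≤n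
∈⇒∣p∣>0 {p = outside ∷ p} (there x∈p) = ∈⇒∣p∣>0 x∈p

fresh : ∀ {n} (p : Subset n) → ∣ p ∣ < n → Σ (Fin n) λ x → ¬ (x Sub.∈ p)
fresh (outside ∷ p) _ = fzero , λ ()
fresh (inside ∷ p) (s≤s ∣p∣<n) with fresh p ∣p∣<n
... | x , x∉p = fsuc x , λ { (there x∈p) → x∉p x∈p }

listSubset : ∀ {n} → List (Fin n) → Subset n
listSubset l = ⋃ (map ⁅_⁆ l)

∣listSubset∣≤length : ∀ {n} (l : List (Fin n)) → ∣ listSubset l ∣ ≤ length l
∣listSubset∣≤length l =
  subst (∣ listSubset l ∣ ≤_) (*-identityʳ (length l))
        (∣⋃-map∣≤ ⁅_⁆ (λ x → subst (_≤ 1) (sym (∣⁅x⁆∣≡1 x)) (s≤s z≤n)) l)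

∈-listSubset : ∀ {n} {x : Fin n} (l : List (Fin n)) → x ∈ l → x Sub.∈ listSubset l
∈-listSubset l x∈l = ∈-⋃-map ⁅_⁆ l x∈l (x∈⁅x⁆ _)

LocalConnection : Set → ℕ → Set → ℕ → Set
LocalConnection A k B k' =
  Σ (FinSubsetLe A k → B) λ f → Σ (FinSubsetLe B k' → A) λ g →
    ∀ s t → f s ∈ proj₁ t → ¬ (g t ∈ proj₁ s)

-- If [n]^{≤k} ∖ {∅} embeds into an inhabited B and k'·k < n, a local
-- connection exists: f encodes s, g picks a point outside the union of
-- the decoded members of t.
localConnection : ∀ n k k' {B : Set} → B → CardLe (NonemptySubsetsLe n k) B →
  k' * k < n → LocalConnection (Fin n) k B k'
localConnection n k k' {B} b₀ (encode , decode , decode∘encode) k'k<n = f , g , separated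
  where
  support : B → Subset n
  support code = proj₁ (decode code)

  f : FinSubsetLe (Fin n) k → B
  f ([] , _) = b₀
  f (x ∷ l , len) = encode (listSubset (x ∷ l) ,
    ∈⇒∣p∣>0 (∈-listSubset (x ∷ l) (here refl)) , ≤-trans (∣listSubset∣≤length (x ∷ l)) len)

  ⊆-support-f : ∀ s {y} → y ∈ proj₁ s → y Sub.∈ support (f s)
  ⊆-support-f (x ∷ l , _) y∈s =
    subst (λ u → _ Sub.∈ proj₁ u) (sym (decode∘encode _)) (∈-listSubset (x ∷ l) y∈s)

  covered<n : (t : List B) → length t ≤ k' → ∣ ⋃ (map support t) ∣ < n
  covered<n t len =
    ≤-<-trans (≤-trans (∣⋃-map∣≤ support (λ code → proj₂ (proj₂ (decode code))) t) (*-monoˡ-≤ k len)) k'k<n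

  g : FinSubsetLe B k' → Fin n
  g (t , len) = proj₁ (fresh (⋃ (map support t)) (covered<n t len))

  separated : ∀ s t → f s ∈ proj₁ t → ¬ (g t ∈ proj₁ s)
  separated s (t , len) fs∈t gt∈s =
    proj₂ (fresh _ (covered<n t len)) (∈-⋃-map support t fs∈t (⊆-support-f s gt∈s))

coordinatewiseTukey : (e : ℕ → Set) (k : ℕ → ℕ) (e' : ℕ → Set) (k' : ℕ → ℕ) →
  Prod e → Prod e' → AlmostAll (λ i → LocalConnection (e i) (k i) (e' i) (k' i)) →
  aLc e k ⪯T Lc e' k'
coordinatewiseTukey e k e' k' x₀ y₀ (N , local) = F , G , connects
  where
  F : Slalom e k → Prod e'
  F φ i with N ≤? i
  ... | yes N≤i = proj₁ (local i N≤i) (φ i)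
  ... | no _ = y₀ i

  G : Slalom e' k' → Prod e
  G ψ i with N ≤? i
  ... | yes N≤i = proj₁ (proj₂ (local i N≤i)) (ψ i)
  ... | no _ = x₀ i

  separatedAt : ∀ φ ψ i → N ≤ i → F φ i ∈ proj₁ (ψ i) → ¬ (G ψ i ∈ proj₁ (φ i))
  separatedAt φ ψ i N≤i with N ≤? i
  ... | yes N≤i' = proj₂ (proj₂ (local i N≤i')) (φ i) (ψ i)
  ... | no N≰i = ⊥-elim (N≰i N≤i)

  connects : ∀ φ ψ → F φ ∈* ψ → G ψ ∉∞ φ
  connects φ ψ Fφ∈*ψ = almostAll-combine (N , λ _ → id) Fφ∈*ψ (separatedAt φ ψ)

-- A Tukey connection A ⪯T B maps families unbounded in A to families
-- unbounded in B (so 𝔟(B) ≤ 𝔟(A)).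
tukeyUnbounded : ∀ {A B : RelSys} → A ⪯T B → (I : Set) (xs : I → X A) →
  ¬ (Σ (Y A) λ y → ∀ j → R A (xs j) y) →
  Σ (I → X B) λ xs' → ¬ (Σ (Y B) λ y' → ∀ j → R B (xs' j) y')
tukeyUnbounded (F , G , conn) I xs unbounded =
  (λ j → F (xs j)) , λ { (y' , bounds) → unbounded (G y' , λ j → conn (xs j) y' (bounds j)) }

-- ... and pulls families dominating in B back to families dominating in A
-- (so 𝔡(A) ≤ 𝔡(B)).
tukeyDominating : ∀ {A B : RelSys} → A ⪯T B → (J : Set) (ys : J → Y B) →
  (∀ x' → Σ J λ j → R B x' (ys j)) →
  Σ (J → Y A) λ ys' → ∀ x → Σ J λ j → R A x (ys' j)
tukeyDominating (F , G , conn) J ys dominating =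
  (λ j → G (ys j)) , λ x → proj₁ (dominating (F x)) , conn x _ (proj₂ (dominating (F x)))

lemma2p6 : (c h : ℕ → ℕ) → (∀ i → 0 < c i) → AlmostAll (λ i → 1 ≤ h i) →
    (C' : ℕ → Set) → ((i : ℕ) → C' i) → (h' : ℕ → ℕ) →
    AlmostAll (λ i → CardLe (NonemptySubsetsLe (c i) (h i)) (C' i) × (h' i * h i < c i)) →
    (aLc (nat c) h ⪯T Lc C' h')
    × ((I : Set) (R₀ : I → Slalom (nat c) h) →
         ¬ (Σ (Prod (nat c)) λ y → ∀ j → y ∉∞ R₀ j) →
         Σ (I → Prod C') λ F → ¬ (Σ (Slalom C' h') λ φ → ∀ j → F j ∈* φ))
    × ((J : Set) (S : J → Slalom C' h') →
         (∀ (x : Prod C') → Σ J λ j → x ∈* S j) →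
         Σ (J → Prod (nat c)) λ E → ∀ (φ : Slalom (nat c) h) → Σ J λ j → E j ∉∞ φ)
lemma2p6 c h c>0 _ C' y₀ h' (N , large) =
  tukey , tukeyUnbounded {aLc (nat c) h} {Lc C' h'} tukey
        , tukeyDominating {aLc (nat c) h} {Lc C' h'} tukey
  where
  local : ∀ i → N ≤ i → LocalConnection (Fin (c i)) (h i) (C' i) (h' i)
  local i N≤i = localConnection (c i) (h i) (h' i) (y₀ i) (proj₁ (large i N≤i)) (proj₂ (large i N≤i))

  tukey : aLc (nat c) h ⪯T Lc C' h'
  tukey = coordinatewiseTukey (nat c) h C' h' (λ i → fromℕ< (c>0 i)) y₀ (N , local)
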